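{- Let $(N_1,C_1)$ and $(N_2,C_2)$ be coherent nets, where $C_1,C_2$ are Presburger formulas over the places of $N_1,N_2$, and let $E$ be a Presburger formula with free variables in $P_1\cup P_2$. For $i=1,2$ let $\tau^*_{C_i}$ be a Presburger formula such that for every marking $m\models C_i$ of $N_i$ and every marking $m'$, $\tau^*_{C_i}(m,m')$ holds iff $m\xRightarrow{\epsilon}m'$ in $N_i$. If $(N_1,C_1)\preceq_E(N_2,C_2)$, then the following formulas are all valid: (Core 0), for each $i\in\{1,2\}$: $\forall\vec p,\vec p',a.\ C_i(\vec p)\wedge\overleftarrow{T}_{C_i}(\vec p,\vec p',a)\implies\exists\vec p''.\ C_i(\vec p'')\wedge\overleftarrow{T}_{C_i}(\vec p,\vec p'',a)\wedge\tau^*_{C_i}(\vec p'',\vec p')$ (built from $N_i$); (Core 1) $\forall\vec x.\ C_1(\vec x)\implies\exists\vec y.\ \tilde E(\vec x,\vec y)\wedge C_2(\vec y)$; (Core 2) $\forall\vec p_1,\vec p_2,\vec p_1'.\ \tilde E(\vec p_1,\vec p_2)\wedge\tau_1(\vec p_1,\vec p_1')\implies\tilde E(\vec p_1',\vec p_2)$; (Core 3) $\forall\vec p_1,\vec p_2,a,\vec p_1',\vec p_2'.\ C_1(\vec p_1)\wedge\tilde E(\vec p_1,\vec p_2)\wedge C_2(\vec p_2)\wedge\hat T_{C_1}(\vec p_1,\vec p_1',a)\wedge\tilde E(\vec p_1',\vec p_2')\implies\hat T_{C_2}(\vec p_2,\vec p_2',a)$.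
   Context: A labeled Petri net $N=(P,T,\mathrm{Pre},\mathrm{Post})$ has finite place set $P=\{p_1,\dots,p_n\}$, finite transition set $T$, $\mathrm{Pre},\mathrm{Post}:T\to(P\to\mathbb N)$, and labeling $l:T\to\Sigma\cup\{\tau\}$, $\tau$ silent. Labels are encoded as natural numbers: $\Sigma\subseteq\mathbb N\setminus\{0\}$, $\tau$ encoded by $0$. Markings $m:P\to\mathbb N$ are identified with vectors. $t$ is enabled at $m$ if $m\ge\mathrm{Pre}(t)$, and then $m\xrightarrow{t}m'$ with $m'=m-\mathrm{Pre}(t)+\mathrm{Post}(t)$; $m\xRightarrow{\varrho}m'$ is firing along $\varrho\in T^*$. Extend $l$ to $T^*$ by erasing $\tau$. For $\sigma\in\Sigma^*$, $m\xRightarrow{\sigma}m'$ means some $\varrho$ with $l(\varrho)=\sigma$ has $m\xRightarrow{\varrho}m'$ ($m\xRightarrow{\epsilon}m'$: silent reachability). $m\overset{\epsilon}{\twoheadrightarrow}m'$ iff $m=m'$; for $\sigma\in\Sigma^*,a\in\Sigma$, $m\overset{\sigma a}{\twoheadrightarrow}m'$ iff there exist $m''$, $t$ with $l(t)=a$ and $m\xRightarrow{\sigma}m''\xrightarrow{t}m'$. $(N,C)$ is a coherent net if for every $m\models C$, $\sigma\in\Sigma^*$, $m\xRightarrow{\sigma}m'$ there is $m''\models C$ with $m\overset{\sigma}{\twoheadrightarrow}m''$ and $m''\xRightarrow{\epsilon}m'$. For a net $N$: $\mathrm{ENBL}_t(\vec x)\triangleq\bigwedge_i x_i\ge\mathrm{Pre}(t,p_i)$;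 $\Delta_t(\vec x,\vec x')\triangleq\bigwedge_i x_i'=x_i+\mathrm{Post}(t,p_i)-\mathrm{Pre}(t,p_i)$; $T(\vec x,\vec x',a)\triangleq\bigvee_{t\in T,\,l(t)\ne\tau}(\mathrm{ENBL}_t\wedge\Delta_t\wedge a=l(t))$; $\tau(\vec x,\vec x')\triangleq\bigvee_{t\in T,\,l(t)=\tau}(\mathrm{ENBL}_t(\vec x)\wedge\Delta_t(\vec x,\vec x'))$ ($\tau_1$ is this formula for $N_1$); $\overleftarrow{T}_C(\vec x,\vec x',a)\triangleq\exists\vec x''.\tau^*_C(\vec x,\vec x'')\wedge T(\vec x'',\vec x',a)$; $\hat T_C(\vec x,\vec x',a)\triangleq(\exists\vec x_1.\overleftarrow{T}_C(\vec x,\vec x_1,a)\wedge C(\vec x_1)\wedge\tau^*_C(\vec x_1,\vec x'))\vee(a=0\wedge\tau^*_C(\vec x,\vec x'))$. All variables range over $\mathbb N$ and "valid" means true for all assignments. $\tilde E(\vec x,\vec y)$ is $E$ with places of $N_1$ replaced by variables $\vec x$, places of $N_2$ replaced by $\vec y$ (bound variables renamed apart), conjoined with $x_i=y_j$ whenever place $p^1_i$ of $N_1$ equals place $p^2_j$ of $N_2$. For markings $m_1,m_2$, $m_1\equiv_E m_2$ means $\tilde E(m_1,m_2)$ holds, and $m_1\langle C_1EC_2\rangle m_2$ means $m_1\models C_1$, $m_1\equiv_E m_2$, $m_2\models C_2$. $(N_1,C_1)\preceq_E(N_2,C_2)$ means: (S1) for every $m_1\models C_1$ there is $m_2$ with $m_1\langle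 C_1EC_2\rangle m_2$; (S2) for all $m_1\xRightarrow{\epsilon}m_1'$ in $N_1$ and all $m_2$, $m_1\equiv_E m_2$ implies $m_1'\equiv_E m_2$; (S3) for all $\sigma\in\Sigma^*$, $m_1\xRightarrow{\sigma}m_1'$ in $N_1$ and $m_2,m_2'$ with $m_1\langle C_1EC_2\rangle m_2$ and $m_1'\equiv_E m_2'$, we have $m_2\xRightarrow{\sigma}m_2'$ in $N_2$. -}

module Defs where

open import Data.Nat using (ℕ; zero; suc; _+_; _*_; _≤_)
open import Data.Fin using (Fin)
open import Data.List using (List; []; _∷_; _∷ʳ_)
open import Data.List.Relation.Unary.All using (All)
open import Data.Product using (Σ; ∃; _×_; _,_)
open import Data.Sum using (_⊎_)
open import Data.Empty using (⊥)
open import Data.Unit using (⊤)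
open import Relation.Nullary using (¬_)
open import Relation.Binary.PropositionalEquality using (_≡_; _≢_)
open import Data.Vec.Functional using (Vector) renaming (_∷_ to _◂_; _++_ to _⧺_)

data Term (k : ℕ) : Set where
  const : ℕ → Term k
  var   : Fin k → Term k
  _⊕_   : Term k → Term k → Term k
  _⊛_   : ℕ → Term k → Term k

data Formula : ℕ → Set where
  tt ff   : ∀ {k} → Formula k
  _≐_ _≼_ : ∀ {k} → Term k → Term k → Formula k
  ¬'_     : ∀ {k} → Formula k → Formula k
  _∧'_ _∨'_ : ∀ {k} → Formula k → Formula k → Formula k
  ∃' ∀'   : ∀ {k} → Formula (suc k) → Formula k

Env : ℕ → Set
Env k = Vector ℕ k

evalT : ∀ {k} → Term k → Env k → ℕ
evalT (const c) ρ = c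
evalT (var i)   ρ = ρ i
evalT (s ⊕ t)   ρ = evalT s ρ + evalT t ρ
evalT (c ⊛ t)   ρ = c * evalT t ρ

⟦_⟧ : ∀ {k} → Formula k → Env k → Set
⟦ tt ⟧ ρ = ⊤
⟦ ff ⟧ ρ = ⊥
⟦ s ≐ t ⟧ ρ = evalT s ρ ≡ evalT t ρ
⟦ s ≼ t ⟧ ρ = evalT s ρ ≤ evalT t ρ
⟦ ¬' φ ⟧ ρ = ¬ ⟦ φ ⟧ ρ
⟦ φ ∧' ψ ⟧ ρ = ⟦ φ ⟧ ρ × ⟦ ψ ⟧ ρ
⟦ φ ∨' ψ ⟧ ρ = ⟦ φ ⟧ ρ ⊎ ⟦ ψ ⟧ ρ
⟦ ∃' φ ⟧ ρ = Σ ℕ λ x → ⟦ φ ⟧ (x ◂ ρ)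
⟦ ∀' φ ⟧ ρ = (x : ℕ) → ⟦ φ ⟧ (x ◂ ρ)

⟦_⟧₂ : ∀ {n} → Formula (n + n) → Env n → Env n → Set
⟦ φ ⟧₂ x x' = ⟦ φ ⟧ (x ⧺ x')

-- Labeled Petri nets with n places (places = Fin n)
-- labels are naturals, 0 encodes the silent label τ

record Net (n : ℕ) : Set where
  field
    nT    : ℕ
    pre   : Fin nT → Fin n → ℕ
    post  : Fin nT → Fin n → ℕ
    label : Fin nT → ℕ

open Net public

Marking : ℕ → Set
Marking n = Vector ℕ n

module _ {n : ℕ} (N : Net n) where

  Trans : Set
  Trans = Fin (nT N)

  ENBL : Trans → Marking n → Set
  ENBL t x = ∀ i → pre N t i ≤ x i

  -- Δ_t(x,x') :  x'_i = x_i + Post(t,p_i) - Pre(t,p_i)   (equation over ℤ,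
  -- written equivalently over ℕ)
  Δ : Trans → Marking n → Marking n → Set
  Δ t x x' = ∀ i → x' i + pre N t i ≡ x i + post N t i

  Step : Marking n → Trans → Marking n → Set
  Step m t m' = ENBL t m × Δ t m m'

  data Fires : Marking n → List Trans → Marking n → Set where
    done : ∀ {m} → Fires m [] m
    step : ∀ {m m' m'' t ρ} → Step m t m' → Fires m' ρ m'' → Fires m (t ∷ ρ) m''

  erase : List Trans → List ℕ
  erase [] = []
  erase (t ∷ ρ) with label N t
  ... | zero  = erase ρ
  ... | suc a = suc a ∷ erase ρ

  Reach : Marking n → List ℕ → Marking n → Set
  Reach m σ m' = Σ (List Trans) λ ρ → Fires m ρ m' × erase ρ ≡ σ

  data Reach↠ : Marking n → List ℕ → Marking n → Set where
    eps  : ∀ {m} → Reach↠ m [] m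
    last : ∀ {m m'' m' σ a} (t : Trans) → label N t ≡ a →
           Reach m σ m'' → Step m'' t m' → Reach↠ m (σ ∷ʳ a) m'

  Tf : Marking n → Marking n → ℕ → Set
  Tf x x' a = Σ Trans λ t → label N t ≢ 0 × ENBL t x × Δ t x x' × a ≡ label N t

  τf : Marking n → Marking n → Set
  τf x x' = Σ Trans λ t → label N t ≡ 0 × ENBL t x × Δ t x x'

  module _ (τs : Formula (n + n)) where
    Tback : Marking n → Marking n → ℕ → Set
    Tback x x' a = Σ (Marking n) λ x'' → ⟦ τs ⟧₂ x x'' × Tf x'' x' a

    That : Formula n → Marking n → Marking n → ℕ → Set
    That C x x' a =
      (Σ (Marking n) λ x₁ → Tback x x₁ a × ⟦ C ⟧ x₁ × ⟦ τs ⟧₂ x₁ x')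
      ⊎ (a ≡ 0 × ⟦ τs ⟧₂ x x')

Word : List ℕ → Set
Word σ = All (λ a → a ≢ 0) σ

Coherent : ∀ {n} → Net n → Formula n → Set
Coherent {n} N C =
  ∀ (m : Marking n) → ⟦ C ⟧ m → ∀ σ (m' : Marking n) → Word σ → Reach N m σ m' →
  Σ (Marking n) λ m'' → ⟦ C ⟧ m'' × Reach↠ N m σ m'' × Reach N m'' [] m'

IsTauStar : ∀ {n} → Net n → Formula n → Formula (n + n) → Set
IsTauStar {n} N C τs =
  ∀ (m : Marking n) → ⟦ C ⟧ m → ∀ (m' : Marking n) →
  (⟦ τs ⟧₂ m m' → Reach N m [] m') × (Reach N m [] m' → ⟦ τs ⟧₂ m m')

-- Shared places: the global place set is Fin n; N₁'s places are embedded by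
-- ι₁ : Fin n₁ → Fin n, N₂'s by ι₂ : Fin n₂ → Fin n (injective), and every
-- place belongs to P₁ ∪ P₂.

record PlaceSetup (n₁ n₂ n : ℕ) : Set where
  field
    ι₁ : Fin n₁ → Fin n
    ι₂ : Fin n₂ → Fin n
    ι₁-inj : ∀ i j → ι₁ i ≡ ι₁ j → i ≡ j
    ι₂-inj : ∀ i j → ι₂ i ≡ ι₂ j → i ≡ j
    cover  : ∀ p → (Σ (Fin n₁) λ i → ι₁ i ≡ p) ⊎ (Σ (Fin n₂) λ j → ι₂ j ≡ p)

open PlaceSetup public

-- Ẽ(x,y): E with places of N₁ replaced by x, of N₂ by y, and x_i = y_j
-- for shared places p¹_i = p²_j.
Ẽ : ∀ {n₁ n₂ n} → PlaceSetup n₁ n₂ n → Formula n → Marking n₁ → Marking n₂ → Set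
Ẽ {n = n} S E x y =
  Σ (Env n) λ v → (∀ i → v (ι₁ S i) ≡ x i) × (∀ j → v (ι₂ S j) ≡ y j) × ⟦ E ⟧ v

Simulated : ∀ {n₁ n₂ n} → PlaceSetup n₁ n₂ n →
            Net n₁ → Formula n₁ → Formula n → Net n₂ → Formula n₂ → Set
Simulated {n₁} {n₂} S N₁ C₁ E N₂ C₂ =
  (∀ (m₁ : Marking n₁) → ⟦ C₁ ⟧ m₁ →
     Σ (Marking n₂) λ m₂ → Ẽ S E m₁ m₂ × ⟦ C₂ ⟧ m₂)
  × (∀ (m₁ m₁' : Marking n₁) (m₂ : Marking n₂) →
       Reach N₁ m₁ [] m₁' → Ẽ S E m₁ m₂ → Ẽ S E m₁' m₂)
  × (∀ σ (m₁ m₁' : Marking n₁) (m₂ m₂' : Marking n₂) → Word σ →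
       Reach N₁ m₁ σ m₁' →
       ⟦ C₁ ⟧ m₁ → Ẽ S E m₁ m₂ → ⟦ C₂ ⟧ m₂ → Ẽ S E m₁' m₂' →
       Reach N₂ m₂ σ m₂')

Core0 : ∀ {n} → Net n → Formula n → Formula (n + n) → Set
Core0 {n} N C τs =
  ∀ (p p' : Marking n) (a : ℕ) → ⟦ C ⟧ p → Tback N τs p p' a →
  Σ (Marking n) λ p'' → ⟦ C ⟧ p'' × Tback N τs p p'' a × ⟦ τs ⟧₂ p'' p'

Core1 : ∀ {n₁ n₂ n} → PlaceSetup n₁ n₂ n → Formula n₁ → Formula n → Formula n₂ → Set
Core1 {n₁} {n₂} S C₁ E C₂ =
  ∀ (x : Marking n₁) → ⟦ C₁ ⟧ x → Σ (Marking n₂) λ y → Ẽ S E x y × ⟦ C₂ ⟧ y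

Core2 : ∀ {n₁ n₂ n} → PlaceSetup n₁ n₂ n → Net n₁ → Formula n → Set
Core2 {n₁} {n₂} S N₁ E =
  ∀ (p₁ : Marking n₁) (p₂ : Marking n₂) (p₁' : Marking n₁) →
  Ẽ S E p₁ p₂ → τf N₁ p₁ p₁' → Ẽ S E p₁' p₂

Core3 : ∀ {n₁ n₂ n} → PlaceSetup n₁ n₂ n →
        Net n₁ → Formula n₁ → Formula (n₁ + n₁) → Formula n →
        Net n₂ → Formula n₂ → Formula (n₂ + n₂) → Set
Core3 {n₁} {n₂} S N₁ C₁ τs₁ E N₂ C₂ τs₂ =
  ∀ (p₁ : Marking n₁) (p₂ : Marking n₂) (a : ℕ) (p₁' : Marking n₁) (p₂' : Marking n₂) →
  ⟦ C₁ ⟧ p₁ → Ẽ S E p₁ p₂ → ⟦ C₂ ⟧ p₂ → That N₁ τs₁ C₁ p₁ p₁' a → Ẽ S E p₁' p₂' →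
  That N₂ τs₂ C₂ p₂ p₂' a

module Submission where

open import Defs
open import Data.Nat using (ℕ; zero; suc; _+_)
open import Data.Nat.Properties using (1+n≢0)
open import Data.Product using (Σ; _×_; _,_; proj₁; proj₂)
open import Data.Sum using (inj₁; inj₂)
open import Data.Empty using (⊥-elim)
open import Data.List using (List; []; _∷_; _++_)
open import Data.List.Properties using (++-identityʳ; ∷ʳ-injective)
open import Data.List.Relation.Unary.All using ([]; _∷_)
open import Relation.Binary.PropositionalEquality using (_≡_; _≢_; refl; sym; trans; cong; subst)

-- Every core formula states, for one transition label a, a property of runs
-- whose visible word is ⌊ a ⌋ (empty for τ = 0).  The formulas ←T and ^T are
-- exactly the single-label runs, cut at markings satisfying C; coherence lets a
-- run with visible word [a] be cut there, and τ* characterises the silent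
-- parts.  Core 1 and 2 are (S1) and (S2) for one-transition runs, and Core 3 is
-- (S3) for the word ⌊ a ⌋, translated through this correspondence on both sides.

⌊_⌋ : ℕ → List ℕ
⌊ zero ⌋  = []
⌊ suc a ⌋ = suc a ∷ []

⌊⌋-word : ∀ a → Word ⌊ a ⌋
⌊⌋-word zero    = []
⌊⌋-word (suc a) = (λ ()) ∷ []

module _ {n : ℕ} (N : Net n) where

  fires-++ : ∀ {m m' m'' ρ ρ'} → Fires N m ρ m' → Fires N m' ρ' m'' → Fires N m (ρ ++ ρ') m''
  fires-++ done       g = g
  fires-++ (step s f) g = step s (fires-++ f g)

  erase-++ : ∀ ρ ρ' → erase N (ρ ++ ρ') ≡ erase N ρ ++ erase N ρ'
  erase-++ []      ρ' = refl
  erase-++ (t ∷ ρ) ρ' with label N t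
  ... | zero  = erase-++ ρ ρ'
  ... | suc a = cong (suc a ∷_) (erase-++ ρ ρ')

  erase-[_] : ∀ t → erase N (t ∷ []) ≡ ⌊ label N t ⌋
  erase-[ t ] with label N t
  ... | zero  = refl
  ... | suc a = refl

  reach-++ : ∀ {m m' m'' σ σ'} → Reach N m σ m' → Reach N m' σ' m'' → Reach N m (σ ++ σ') m''
  reach-++ (ρ , f , refl) (ρ' , g , refl) = ρ ++ ρ' , fires-++ f g , erase-++ ρ ρ'

  reach-silentʳ : ∀ {m m' m'' σ} → Reach N m σ m' → Reach N m' [] m'' → Reach N m σ m''
  reach-silentʳ {σ = σ} r r' = subst (λ w → Reach N _ w _) (++-identityʳ σ) (reach-++ r r')

  step⇒reach : ∀ {m m' a} t → a ≡ label N t → Step N m t m' → Reach N m ⌊ a ⌋ m'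
  step⇒reach t refl s = t ∷ [] , step s done , erase-[ t ]

  reach↠-[_]⁻¹ : ∀ a {m m'} → Reach↠ N m (a ∷ []) m' →
    Σ (Marking n) λ m'' → Σ (Trans N) λ t → label N t ≡ a × Reach N m [] m'' × Step N m'' t m'
  reach↠-[ a ]⁻¹ r = invert r refl
    where
    invert : ∀ {m σ m'} → Reach↠ N m σ m' → σ ≡ a ∷ [] →
      Σ (Marking n) λ m'' → Σ (Trans N) λ t → label N t ≡ a × Reach N m [] m'' × Step N m'' t m'
    invert (last {m'' = m''} {σ = σ} t lt r s) eq with ∷ʳ-injective σ [] eq
    ... | refl , refl = m'' , t , lt , r , s

  Tback-label≢0 : ∀ {τs x x' a} → Tback N τs x x' a → a ≢ 0
  Tback-label≢0 (_ , _ , t , lt≢0 , _ , _ , refl) = lt≢0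

  module _ {C : Formula n} {τs : Formula (n + n)} (τ*-spec : IsTauStar N C τs) where

    τ*⇒reach : ∀ {m m'} → ⟦ C ⟧ m → ⟦ τs ⟧₂ m m' → Reach N m [] m'
    τ*⇒reach {m} {m'} c = proj₁ (τ*-spec m c m')

    reach⇒τ* : ∀ {m m'} → ⟦ C ⟧ m → Reach N m [] m' → ⟦ τs ⟧₂ m m'
    reach⇒τ* {m} {m'} c = proj₂ (τ*-spec m c m')

    Tback⇒reach : ∀ {m m' a} → ⟦ C ⟧ m → Tback N τs m m' a → Reach N m ⌊ a ⌋ m'
    Tback⇒reach c (_ , τ , t , _ , en , d , a≡lt) =
      reach-++ (τ*⇒reach c τ) (step⇒reach t a≡lt (en , d))

    That⇒reach : ∀ {m m' a} → ⟦ C ⟧ m → That N τs C m m' a → Reach N m ⌊ a ⌋ m'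
    That⇒reach c (inj₁ (_ , tb , c₁ , τ)) = reach-silentʳ (Tback⇒reach c tb) (τ*⇒reach c₁ τ)
    That⇒reach c (inj₂ (refl , τ))        = τ*⇒reach c τ

    module _ (coherent : Coherent N C) where

      reach-visible⇒Tback : ∀ {m m'} a → ⟦ C ⟧ m → Reach N m (suc a ∷ []) m' →
        Σ (Marking n) λ m'' → ⟦ C ⟧ m'' × Tback N τs m m'' (suc a) × ⟦ τs ⟧₂ m'' m'
      reach-visible⇒Tback {m} {m'} a c r
        with coherent m c (suc a ∷ []) m' ((λ ()) ∷ []) r
      ... | m'' , c'' , r↠ , r''
        with reach↠-[ suc a ]⁻¹ r↠
      ... | m₀ , t , lt , r₀ , (en , d) =
        m'' , c'' , (m₀ , reach⇒τ* c r₀ , t , (λ lt≡0 → 1+n≢0 (trans (sym lt) lt≡0)) , en , d , sym lt)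
            , reach⇒τ* c'' r''

      reach⇒That : ∀ {m m'} a → ⟦ C ⟧ m → Reach N m ⌊ a ⌋ m' → That N τs C m m' a
      reach⇒That zero    c r = inj₂ (refl , reach⇒τ* c r)
      reach⇒That (suc a) c r with reach-visible⇒Tback a c r
      ... | m'' , c'' , tb , τ = inj₁ (m'' , tb , c'' , τ)

      core0 : Core0 N C τs
      core0 _ _ zero    c tb = ⊥-elim (Tback-label≢0 tb refl)
      core0 _ _ (suc a) c tb = reach-visible⇒Tback a c (Tback⇒reach c tb)

theorem4 : ∀ {n₁ n₂ n} (S : PlaceSetup n₁ n₂ n)
    (N₁ : Net n₁) (C₁ : Formula n₁) (τs₁ : Formula (n₁ + n₁))
    (N₂ : Net n₂) (C₂ : Formula n₂) (τs₂ : Formula (n₂ + n₂))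
    (E : Formula n) →
    Coherent N₁ C₁ → Coherent N₂ C₂ →
    IsTauStar N₁ C₁ τs₁ → IsTauStar N₂ C₂ τs₂ →
    Simulated S N₁ C₁ E N₂ C₂ →
    Core0 N₁ C₁ τs₁ × Core0 N₂ C₂ τs₂ × Core1 S C₁ E C₂ × Core2 S N₁ E
    × Core3 S N₁ C₁ τs₁ E N₂ C₂ τs₂
theorem4 S N₁ C₁ τs₁ N₂ C₂ τs₂ E coh₁ coh₂ τ*₁ τ*₂ (s1 , s2 , s3) =
  core0 N₁ τ*₁ coh₁ , core0 N₂ τ*₂ coh₂ , s1 , core2 , core3
  where
  core2 : Core2 S N₁ E
  core2 p₁ p₂ p₁' e (t , lt≡0 , en , d) =
    s2 p₁ p₁' p₂ (step⇒reach N₁ t (sym lt≡0) (en , d)) e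

  core3 : Core3 S N₁ C₁ τs₁ E N₂ C₂ τs₂
  core3 p₁ p₂ a p₁' p₂' c₁ e c₂ t̂ e' =
    reach⇒That N₂ τ*₂ coh₂ a c₂
      (s3 ⌊ a ⌋ p₁ p₁' p₂ p₂' (⌊⌋-word a) (That⇒reach N₁ τ*₁ c₁ t̂) c₁ e c₂ e')
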